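{- Let $d$ be a positive even integer and let $x_1\neq x_2$ be complex numbers. Put $c'=-x_1-x_2^d$. Then $x_1$ and $x_2$ are fixed points of $f_{d,c}(x)=x^d+c$ for some $c\in\mathbb{C}$ (namely $c=x_1-x_1^d$) if and only if $y_1=-x_1$ and $y_2=-x_2$ are points of exact period $2$ of $f_{d,c'}(x)=x^d+c'$.
   Context: A point $y$ has exact period $2$ for $f$ if $f(f(y))=y$ and $f(y)\neq y$. -}

module Defs where

open import Level using (Level)
open import Data.Nat using (ℕ; zero; suc)
open import Data.Product using (_×_)
open import Relation.Nullary using (¬_)
open import Algebra.Bundles using (CommutativeRing)

module _ {c ℓ : Level} (R : CommutativeRing c ℓ) where
  open CommutativeRing R

  pow : Carrier → ℕ → Carrier
  pow x zero    = 1#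
  pow x (suc n) = x * pow x n

  fdc : ℕ → Carrier → Carrier → Carrier
  fdc d k x = pow x d + k

  IsFixed : (Carrier → Carrier) → Carrier → Set ℓ
  IsFixed f y = f y ≈ y

  ExactPeriod2 : (Carrier → Carrier) → Carrier → Set ℓ
  ExactPeriod2 f y = (f (f y) ≈ y) × ¬ (f y ≈ y)

-- Since d is even, f(-x) = x^d + c′ for f = f_{d,c′}. With c′ = -x₁ - x₂^d this gives
-- f(-x₂) = -x₁ unconditionally, so -x₁, -x₂ form a 2-cycle exactly when
-- f(-x₁) = x₁^d - x₁ - x₂^d equals -x₂, i.e. when x₁ - x₁^d = x₂ - x₂^d, which is
-- the condition for a single constant c to fix both x₁ and x₂.
module Submission where

open import Defs
open import Level using (Level)
open import Data.Nat using (ℕ; _<_; zero; suc) renaming (_*_ to _*ℕ_)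
open import Data.Nat.Divisibility using (_∣_; divides)
open import Data.Product using (Σ; _×_; _,_)
open import Relation.Nullary using (¬_)
open import Function.Bundles using (_⇔_; mk⇔)
open import Function.Properties.Equivalence using () renaming (trans to ⇔-trans)
open import Algebra.Bundles using (Group; AbelianGroup; CommutativeRing)
open import Relation.Binary.PropositionalEquality as ≡ using ()
import Relation.Binary.Reasoning.Setoid as SetoidReasoning

module _ {a ℓ : Level} (G : AbelianGroup a ℓ) where
  open AbelianGroup G
  open Group group using (_\\_)
  open import Algebra.Properties.Group group
    using (\\-leftDividesˡ; ⁻¹-anti-homo-∙; ⁻¹-anti-homo-\\; ⁻¹-injective; quasigroup)
  open import Algebra.Properties.Quasigroup quasigroup using (y≈x\\z)
  open SetoidReasoning setoid

  u∙[x⁻¹∙v⁻¹]≈[v∙[u\\x]]⁻¹ : ∀ u x v → u ∙ (x ⁻¹ ∙ v ⁻¹) ≈ (v ∙ (u \\ x)) ⁻¹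
  u∙[x⁻¹∙v⁻¹]≈[v∙[u\\x]]⁻¹ u x v = begin
    u ∙ (x ⁻¹ ∙ v ⁻¹)   ≈⟨ assoc u (x ⁻¹) (v ⁻¹) ⟨
    u ∙ x ⁻¹ ∙ v ⁻¹     ≈⟨ ∙-congʳ (comm u (x ⁻¹)) ⟩
    (x \\ u) ∙ v ⁻¹     ≈⟨ ∙-congʳ (⁻¹-anti-homo-\\ u x) ⟨
    (u \\ x) ⁻¹ ∙ v ⁻¹  ≈⟨ ⁻¹-anti-homo-∙ v (u \\ x) ⟨
    (v ∙ (u \\ x)) ⁻¹   ∎

  commonTranslate⇔ : ∀ u v x y →
    (Σ Carrier λ k → u ∙ k ≈ x × v ∙ k ≈ y) ⇔ (u ∙ (x ⁻¹ ∙ v ⁻¹) ≈ y ⁻¹)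
  commonTranslate⇔ u v x y = mk⇔ to from
    where
    to : (Σ Carrier λ k → u ∙ k ≈ x × v ∙ k ≈ y) → u ∙ (x ⁻¹ ∙ v ⁻¹) ≈ y ⁻¹
    to (k , uk≈x , vk≈y) = begin
      u ∙ (x ⁻¹ ∙ v ⁻¹)  ≈⟨ u∙[x⁻¹∙v⁻¹]≈[v∙[u\\x]]⁻¹ u x v ⟩
      (v ∙ (u \\ x)) ⁻¹  ≈⟨ ⁻¹-cong (∙-congˡ (y≈x\\z u k x uk≈x)) ⟨
      (v ∙ k) ⁻¹         ≈⟨ ⁻¹-cong vk≈y ⟩
      y ⁻¹               ∎

    from : u ∙ (x ⁻¹ ∙ v ⁻¹) ≈ y ⁻¹ → Σ Carrier λ k → u ∙ k ≈ x × v ∙ k ≈ y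
    from e = u \\ x , \\-leftDividesˡ u x
           , ⁻¹-injective (trans (sym (u∙[x⁻¹∙v⁻¹]≈[v∙[u\\x]]⁻¹ u x v)) e)

module _ {c ℓ : Level} (R : CommutativeRing c ℓ) where
  open CommutativeRing R
  open import Algebra.Properties.Ring ring using (-‿distribˡ-*; -‿distribʳ-*)
  open import Algebra.Properties.Group +-group using () renaming (⁻¹-involutive to -‿involutive)
  open SetoidReasoning setoid

  -x*-y≈x*y : ∀ x y → - x * - y ≈ x * y
  -x*-y≈x*y x y = begin
    - x * - y      ≈⟨ -‿distribˡ-* x (- y) ⟨
    - (x * - y)    ≈⟨ -‿cong (-‿distribʳ-* x y) ⟨
    - (- (x * y))  ≈⟨ -‿involutive (x * y) ⟩
    x * y          ∎

  pow-cong : ∀ {x y} n → x ≈ y → pow R x n ≈ pow R y n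
  pow-cong zero    x≈y = refl
  pow-cong (suc n) x≈y = *-cong x≈y (pow-cong n x≈y)

  pow-neg-even : ∀ x {n} → 2 ∣ n → pow R (- x) n ≈ pow R x n
  pow-neg-even x (divides q ≡.refl) = pow-neg-double q
    where
    pow-neg-double : ∀ q → pow R (- x) (q *ℕ 2) ≈ pow R x (q *ℕ 2)
    pow-neg-double zero    = refl
    pow-neg-double (suc q) = begin
      - x * (- x * pow R (- x) (q *ℕ 2))  ≈⟨ *-assoc (- x) (- x) _ ⟨
      - x * - x * pow R (- x) (q *ℕ 2)    ≈⟨ *-cong (-x*-y≈x*y x x) (pow-neg-double q) ⟩
      x * x * pow R x (q *ℕ 2)            ≈⟨ *-assoc x x _ ⟩
      x * (x * pow R x (q *ℕ 2))          ∎

  swap⇔exactPeriod2 : ∀ {f : Carrier → Carrier} → (∀ {x y} → x ≈ y → f x ≈ f y) →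
    ∀ {u v} → f v ≈ u → ¬ (u ≈ v) →
    (f u ≈ v) ⇔ (ExactPeriod2 R f u × ExactPeriod2 R f v)
  swap⇔exactPeriod2 {f} f-cong {u} {v} fv≈u u≉v = mk⇔ to from
    where
    to : f u ≈ v → ExactPeriod2 R f u × ExactPeriod2 R f v
    to fu≈v = (trans (f-cong fu≈v) fv≈u , λ fu≈u → u≉v (trans (sym fu≈u) fu≈v))
            , (trans (f-cong fv≈u) fu≈v , λ fv≈v → u≉v (trans (sym fv≈u) fv≈v))

    from : ExactPeriod2 R f u × ExactPeriod2 R f v → f u ≈ v
    from (_ , (ffv≈v , _)) = trans (f-cong (sym fv≈u)) ffv≈v

lemma4p5 : {c ℓ : Level} (R : CommutativeRing c ℓ) →
    let open CommutativeRing R in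
    (d : ℕ) → 0 < d → 2 ∣ d →
    (x₁ x₂ : Carrier) → ¬ (x₁ ≈ x₂) →
    (Σ Carrier (λ k → IsFixed R (fdc R d k) x₁ × IsFixed R (fdc R d k) x₂))
    ⇔ (ExactPeriod2 R (fdc R d ((- x₁) - pow R x₂ d)) (- x₁)
    × ExactPeriod2 R (fdc R d ((- x₁) - pow R x₂ d)) (- x₂))
lemma4p5 R d _ d-even x₁ x₂ x₁≉x₂ =
  ⇔-trans (commonTranslate⇔ +-abelianGroup (pow R x₁ d) (pow R x₂ d) x₁ x₂)
  (⇔-trans (mk⇔ (trans f[-x₁]≈) (trans (sym f[-x₁]≈)))
           (swap⇔exactPeriod2 R f-cong f[-x₂]≈-x₁ (λ e → x₁≉x₂ (⁻¹-injective e))))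
  where
  open CommutativeRing R
  open import Algebra.Properties.Group +-group using (//-rightDividesˡ; ⁻¹-injective)

  c′ : Carrier
  c′ = - x₁ - pow R x₂ d

  f : Carrier → Carrier
  f = fdc R d c′

  f-cong : ∀ {x y} → x ≈ y → f x ≈ f y
  f-cong x≈y = +-congʳ (pow-cong R d x≈y)

  f[-x₁]≈ : f (- x₁) ≈ pow R x₁ d + c′
  f[-x₁]≈ = +-congʳ (pow-neg-even R x₁ d-even)

  f[-x₂]≈-x₁ : f (- x₂) ≈ - x₁
  f[-x₂]≈-x₁ = trans (+-congʳ (pow-neg-even R x₂ d-even))
                     (trans (+-comm _ c′) (//-rightDividesˡ (pow R x₂ d) (- x₁)))
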